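{- For any Kripke model $\mathbb{M}=(W,R,V)$, any assignment $g$, formulas $\alpha,\beta$, state variable $x$ and state variable $y$ not occurring in $\alpha$ or $\beta$: $\mathbb{M},g\Vdash\alpha\leq\downarrow x.\beta$ iff $\mathbb{M},g\Vdash\forall y(\mathsf{A}(y\to\alpha)\land y\leq\beta[y/x])$, and $\mathbb{M},g\Vdash\downarrow x.\beta\leq\alpha$ iff $\mathbb{M},g\Vdash\forall y(\beta[y/x]\leq y\to\mathsf{E}(y\land\alpha))$. Here $\beta[y/x]$ replaces all occurrences of $x$ in $\beta$ by $y$, and $\mathbb{M},g\Vdash\forall y(\varphi\leq\psi)$ means $\mathbb{M},g^y_w\Vdash\varphi\leq\psi$ for all $w\in W$.
   Context: Formulas are those of the expanded hybrid language with binder (Boolean connectives, $\Box,\Diamond$, nominals, state variables, $@$, $\downarrow$, $\forall x,\exists x$, plus $\blacksquare$ and $\Diamond^{ -1}$ — box and diamond for the converse relation $R^{ -1}$), where $\mathsf{A}$/$\mathsf{E}$ are the global box/diamond. Assignments $g$ send state variables to points, $g^y_w$ is $g$ with $y$ sent to $w$; $\mathbb{M},g,w\Vdash\downarrow x.\varphi$ iff $\mathbb{M},g^x_w,w\Vdash\varphi$; a state variable $y$ is true exactly at $g(y)$. An inequality $\varphi\leq\psi$ holds in $\mathbb{M},g$ iff every point satisfying $\varphi$ satisfies $\psi$. -}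

module Defs where

open import Data.Nat using (ℕ; _≟_)
open import Data.Bool using (Bool; true; false; _∨_)
open import Data.Product using (_×_; Σ)
open import Data.Sum using (_⊎_)
open import Data.Empty using (⊥)
open import Data.Unit using (⊤)
open import Relation.Nullary using (¬_; yes; no; does)
open import Relation.Binary.PropositionalEquality using (_≡_)

PropL : Set
PropL = ℕ
Nom : Set
Nom = ℕ
SVar : Set
SVar = ℕ

data Term : Set where
  nomT : Nom → Term
  varT : SVar → Term

data Fm : Set where
  prop   : PropL → Fm
  nom    : Nom → Fm
  var    : SVar → Fm
  ⊤f ⊥f  : Fm
  ¬f_    : Fm → Fm
  _∧f_   : Fm → Fm → Fm
  _∨f_   : Fm → Fm → Fm
  _→f_   : Fm → Fm → Fm
  □_     : Fm → Fm
  ◇_     : Fm → Fm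
  ■_     : Fm → Fm
  ◇⁻¹_   : Fm → Fm
  A_     : Fm → Fm
  E_     : Fm → Fm
  at_∶_   : Term → Fm → Fm
  ↓_∶_   : SVar → Fm → Fm
  ∀v_∶_  : SVar → Fm → Fm
  ∃v_∶_  : SVar → Fm → Fm

-- Kripke model (W,R,V); V interprets proposition letters and nominals
-- (nominals are true at exactly one point).
record Model : Set₁ where
  field
    W    : Set
    R    : W → W → Set
    V    : PropL → W → Set
    Vnom : Nom → W

Assignment : Model → Set
Assignment M = SVar → Model.W M

upd : {M : Model} → Assignment M → SVar → Model.W M → Assignment M
upd g x w y with y ≟ x
... | yes _ = w
... | no  _ = g y

denT : (M : Model) → Assignment M → Term → Model.W M
denT M g (nomT i) = Model.Vnom M i
denT M g (varT x) = g x

sat : (M : Model) → Assignment M → Model.W M → Fm → Set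
sat M g w (prop p)   = Model.V M p w
sat M g w (nom i)    = Model.Vnom M i ≡ w
sat M g w (var x)    = g x ≡ w
sat M g w ⊤f         = ⊤
sat M g w ⊥f         = ⊥
sat M g w (¬f φ)     = ¬ sat M g w φ
sat M g w (φ ∧f ψ)   = sat M g w φ × sat M g w ψ
sat M g w (φ ∨f ψ)   = sat M g w φ ⊎ sat M g w ψ
sat M g w (φ →f ψ)   = sat M g w φ → sat M g w ψ
sat M g w (□ φ)      = (v : Model.W M) → Model.R M w v → sat M g v φ
sat M g w (◇ φ)      = Σ (Model.W M) (λ v → Model.R M w v × sat M g v φ)
sat M g w (■ φ)      = (v : Model.W M) → Model.R M v w → sat M g v φ
sat M g w (◇⁻¹ φ)    = Σ (Model.W M) (λ v → Model.R M v w × sat M g v φ)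
sat M g w (A φ)      = (v : Model.W M) → sat M g v φ
sat M g w (E φ)      = Σ (Model.W M) (λ v → sat M g v φ)
sat M g w (at t ∶ φ)  = sat M g (denT M g t) φ
sat M g w (↓ x ∶ φ)  = sat M (upd {M} g x w) w φ
sat M g w (∀v x ∶ φ) = (v : Model.W M) → sat M (upd {M} g x v) w φ
sat M g w (∃v x ∶ φ) = Σ (Model.W M) (λ v → sat M (upd {M} g x v) w φ)

Holds≤ : (M : Model) → Assignment M → Fm → Fm → Set
Holds≤ M g φ ψ = (w : Model.W M) → sat M g w φ → sat M g w ψ

Holds∀≤ : (M : Model) → Assignment M → SVar → Fm → Fm → Set
Holds∀≤ M g y φ ψ = (w : Model.W M) → Holds≤ M (upd {M} g y w) φ ψ

eqb : ℕ → ℕ → Bool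
eqb m n = does (m ≟ n)

occT : SVar → Term → Bool
occT y (nomT i) = false
occT y (varT x) = eqb x y

occ : SVar → Fm → Bool
occ y (prop p)   = false
occ y (nom i)    = false
occ y (var x)    = eqb x y
occ y ⊤f         = false
occ y ⊥f         = false
occ y (¬f φ)     = occ y φ
occ y (φ ∧f ψ)   = occ y φ ∨ occ y ψ
occ y (φ ∨f ψ)   = occ y φ ∨ occ y ψ
occ y (φ →f ψ)   = occ y φ ∨ occ y ψ
occ y (□ φ)      = occ y φ
occ y (◇ φ)      = occ y φ
occ y (■ φ)      = occ y φ
occ y (◇⁻¹ φ)    = occ y φ
occ y (A φ)      = occ y φ
occ y (E φ)      = occ y φ
occ y (at t ∶ φ)  = occT y t ∨ occ y φ
occ y (↓ x ∶ φ)  = eqb x y ∨ occ y φ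
occ y (∀v x ∶ φ) = eqb x y ∨ occ y φ
occ y (∃v x ∶ φ) = eqb x y ∨ occ y φ

rnV : SVar → SVar → SVar → SVar
rnV y x z with z ≟ x
... | yes _ = y
... | no  _ = z

rnT : SVar → SVar → Term → Term
rnT y x (nomT i) = nomT i
rnT y x (varT z) = varT (rnV y x z)

_[_/_] : Fm → SVar → SVar → Fm
prop p     [ y / x ] = prop p
nom i      [ y / x ] = nom i
var z      [ y / x ] = var (rnV y x z)
⊤f         [ y / x ] = ⊤f
⊥f         [ y / x ] = ⊥f
(¬f φ)     [ y / x ] = ¬f (φ [ y / x ])
(φ ∧f ψ)   [ y / x ] = (φ [ y / x ]) ∧f (ψ [ y / x ])
(φ ∨f ψ)   [ y / x ] = (φ [ y / x ]) ∨f (ψ [ y / x ])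
(φ →f ψ)   [ y / x ] = (φ [ y / x ]) →f (ψ [ y / x ])
(□ φ)      [ y / x ] = □ (φ [ y / x ])
(◇ φ)      [ y / x ] = ◇ (φ [ y / x ])
(■ φ)      [ y / x ] = ■ (φ [ y / x ])
(◇⁻¹ φ)    [ y / x ] = ◇⁻¹ (φ [ y / x ])
(A φ)      [ y / x ] = A (φ [ y / x ])
(E φ)      [ y / x ] = E (φ [ y / x ])
(at t ∶ φ)  [ y / x ] = at (rnT y x t) ∶ (φ [ y / x ])
(↓ z ∶ φ)  [ y / x ] = ↓ (rnV y x z) ∶ (φ [ y / x ])
(∀v z ∶ φ) [ y / x ] = ∀v (rnV y x z) ∶ (φ [ y / x ])
(∃v z ∶ φ) [ y / x ] = ∃v (rnV y x z) ∶ (φ [ y / x ])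

{-# OPTIONS --safe #-}

-- Two facts carry the argument. First, substituting a fresh y for x, including
-- at binders, is harmless: β[y/x] under g means β under any h that reads x as g
-- reads y and agrees with g elsewhere; with x = y this says a fresh variable can
-- be reassigned at will. Second, A(y → α) ∧ y holds at w under g^y_v exactly when
-- v = w and α holds at w, and dually for y → E(y ∧ α); so ∀y pins y to the point
-- of evaluation, and β[y/x] evaluated there under g^y_w is ↓x.β evaluated at w.
module Submission where

open import Defs
open import Data.Bool using (false)
open import Data.Bool.Properties using (∨-conicalˡ; ∨-conicalʳ)
open import Data.Nat using (_≟_)
open import Data.Product using (_×_; _,_; Σ)
open import Data.Product.Function.NonDependent.Propositional using (_×-⇔_)
open import Data.Sum.Function.Propositional using (_⊎-⇔_)
open import Function.Bundles using (_⇔_; mk⇔; Equivalence)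
open import Function.Properties.Equivalence using (⇔-isEquivalence)
open import Function.Related.TypeIsomorphisms using (→-cong-⇔; ¬-cong-⇔)
open import Level using (Level)
open import Relation.Binary.PropositionalEquality
  using (_≡_; _≢_; refl; sym; trans; subst; cong; cong₂)
open import Relation.Binary.Structures using (IsEquivalence)
open import Relation.Nullary using (yes; no; proof)
open import Relation.Nullary.Negation using (contradiction)
open import Relation.Nullary.Reflects using (Reflects; invert)

module ⇔ {ℓ : Level} = IsEquivalence (⇔-isEquivalence {ℓ})
open Equivalence using (to; from)

private
  variable
    a b : Level

Π-cong-⇔ : {A : Set a} {P Q : A → Set b} →
           (∀ x → P x ⇔ Q x) → ((x : A) → P x) ⇔ ((x : A) → Q x)
Π-cong-⇔ P⇔Q = mk⇔ (λ f x → to (P⇔Q x) (f x)) (λ f x → from (P⇔Q x) (f x))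

Σ-cong-⇔ : {A : Set a} {P Q : A → Set b} →
           (∀ x → P x ⇔ Q x) → Σ A P ⇔ Σ A Q
Σ-cong-⇔ P⇔Q = mk⇔ (λ (x , p) → x , to (P⇔Q x) p) (λ (x , q) → x , from (P⇔Q x) q)

eqb-false⇒≢ : ∀ m n → eqb m n ≡ false → m ≢ n
eqb-false⇒≢ m n e = invert (subst (Reflects (m ≡ n)) e (proof (m ≟ n)))

rnV-self : ∀ y z → rnV y y z ≡ z
rnV-self y z with z ≟ y
... | yes z≡y = sym z≡y
... | no _    = refl

rnV-injective : ∀ {y x c d} → c ≢ y → d ≢ y → rnV y x c ≡ rnV y x d → c ≡ d
rnV-injective {y} {x} {c} {d} c≢y d≢y eq with c ≟ x | d ≟ x
... | yes c≡x | yes d≡x = trans c≡x (sym d≡x)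
... | yes _   | no _    = contradiction (sym eq) d≢y
... | no _    | yes _   = contradiction eq c≢y
... | no _    | no _    = eq

rnT-self : ∀ y t → rnT y y t ≡ t
rnT-self y (nomT i) = refl
rnT-self y (varT z) = cong varT (rnV-self y z)

[/]-self : ∀ y φ → φ [ y / y ] ≡ φ
[/]-self y (prop p)   = refl
[/]-self y (nom i)    = refl
[/]-self y (var z)    = cong var (rnV-self y z)
[/]-self y ⊤f         = refl
[/]-self y ⊥f         = refl
[/]-self y (¬f φ)     = cong ¬f_ ([/]-self y φ)
[/]-self y (φ ∧f ψ)   = cong₂ _∧f_ ([/]-self y φ) ([/]-self y ψ)
[/]-self y (φ ∨f ψ)   = cong₂ _∨f_ ([/]-self y φ) ([/]-self y ψ)
[/]-self y (φ →f ψ)   = cong₂ _→f_ ([/]-self y φ) ([/]-self y ψ)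
[/]-self y (□ φ)      = cong □_ ([/]-self y φ)
[/]-self y (◇ φ)      = cong ◇_ ([/]-self y φ)
[/]-self y (■ φ)      = cong ■_ ([/]-self y φ)
[/]-self y (◇⁻¹ φ)    = cong ◇⁻¹_ ([/]-self y φ)
[/]-self y (A φ)      = cong A_ ([/]-self y φ)
[/]-self y (E φ)      = cong E_ ([/]-self y φ)
[/]-self y (at t ∶ φ)  = cong₂ at_∶_ (rnT-self y t) ([/]-self y φ)
[/]-self y (↓ z ∶ φ)  = cong₂ ↓_∶_ (rnV-self y z) ([/]-self y φ)
[/]-self y (∀v z ∶ φ) = cong₂ ∀v_∶_ (rnV-self y z) ([/]-self y φ)
[/]-self y (∃v z ∶ φ) = cong₂ ∃v_∶_ (rnV-self y z) ([/]-self y φ)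

module _ (M : Model) where
  open Model M

  upd-≡ : (g : Assignment M) (x : SVar) (v : W) → upd {M} g x v x ≡ v
  upd-≡ g x v with x ≟ x
  ... | yes _   = refl
  ... | no x≢x = contradiction refl x≢x

  upd-≢ : (g : Assignment M) {x z : SVar} (v : W) → z ≢ x → upd {M} g x v z ≡ g z
  upd-≢ g {x} {z} v z≢x with z ≟ x
  ... | yes z≡x = contradiction z≡x z≢x
  ... | no _    = refl

  Agree[_/_] : SVar → SVar → Assignment M → Assignment M → Set
  Agree[ y / x ] g h = ∀ z → z ≢ y → g (rnV y x z) ≡ h z

  Agree-upd : ∀ {y x z g h} (v : W) → z ≢ y → Agree[ y / x ] g h →
              Agree[ y / x ] (upd {M} g (rnV y x z) v) (upd {M} h z v)
  Agree-upd {y} {x} {z} {g} v z≢y g~h z′ z′≢y with z′ ≟ z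
  ... | yes refl  = upd-≡ g (rnV y x z) v
  ... | no z′≢z = trans (upd-≢ g v (λ eq → z′≢z (rnV-injective z′≢y z≢y eq)))
                         (g~h z′ z′≢y)

  -- y must be fresh also for binders: a bound y would capture the substituted y.
  sat-[/] : ∀ {y x} φ → occ y φ ≡ false → ∀ {g h} → Agree[ y / x ] g h →
            ∀ w → sat M g w (φ [ y / x ]) ⇔ sat M h w φ
  sat-[/] (prop p) _ _ _ = ⇔.refl
  sat-[/] (nom i)  _ _ _ = ⇔.refl
  sat-[/] {y} (var z) y∉ g~h _ =
    let e = g~h z (eqb-false⇒≢ z y y∉) in mk⇔ (trans (sym e)) (trans e)
  sat-[/] ⊤f _ _ _ = ⇔.refl
  sat-[/] ⊥f _ _ _ = ⇔.refl
  sat-[/] (¬f φ) y∉ g~h w = ¬-cong-⇔ (sat-[/] φ y∉ g~h w)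
  sat-[/] {y} (φ ∧f ψ) y∉ g~h w =
    sat-[/] φ (∨-conicalˡ _ (occ y ψ) y∉) g~h w ×-⇔ sat-[/] ψ (∨-conicalʳ (occ y φ) _ y∉) g~h w
  sat-[/] {y} (φ ∨f ψ) y∉ g~h w =
    sat-[/] φ (∨-conicalˡ _ (occ y ψ) y∉) g~h w ⊎-⇔ sat-[/] ψ (∨-conicalʳ (occ y φ) _ y∉) g~h w
  sat-[/] {y} (φ →f ψ) y∉ g~h w =
    →-cong-⇔ (sat-[/] φ (∨-conicalˡ _ (occ y ψ) y∉) g~h w) (sat-[/] ψ (∨-conicalʳ (occ y φ) _ y∉) g~h w)
  sat-[/] (□ φ)   y∉ g~h _ = Π-cong-⇔ λ v → →-cong-⇔ ⇔.refl (sat-[/] φ y∉ g~h v)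
  sat-[/] (◇ φ)   y∉ g~h _ = Σ-cong-⇔ λ v → ⇔.refl ×-⇔ sat-[/] φ y∉ g~h v
  sat-[/] (■ φ)   y∉ g~h _ = Π-cong-⇔ λ v → →-cong-⇔ ⇔.refl (sat-[/] φ y∉ g~h v)
  sat-[/] (◇⁻¹ φ) y∉ g~h _ = Σ-cong-⇔ λ v → ⇔.refl ×-⇔ sat-[/] φ y∉ g~h v
  sat-[/] (A φ)   y∉ g~h _ = Π-cong-⇔ λ v → sat-[/] φ y∉ g~h v
  sat-[/] (E φ)   y∉ g~h _ = Σ-cong-⇔ λ v → sat-[/] φ y∉ g~h v
  sat-[/] (at nomT i ∶ φ) y∉ g~h _ = sat-[/] φ y∉ g~h (Vnom i)
  sat-[/] {y} {x} (at varT z ∶ φ) y∉ {g} {h} g~h _ =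
    subst (λ u → sat M g (g (rnV y x z)) (φ [ y / x ]) ⇔ sat M h u φ)
          (g~h z (eqb-false⇒≢ z y (∨-conicalˡ _ (occ y φ) y∉)))
          (sat-[/] φ (∨-conicalʳ (eqb z y) _ y∉) g~h (g (rnV y x z)))
  sat-[/] {y} (↓ z ∶ φ) y∉ g~h w =
    sat-[/] φ (∨-conicalʳ (eqb z y) _ y∉)
            (Agree-upd w (eqb-false⇒≢ z y (∨-conicalˡ _ (occ y φ) y∉)) g~h) w
  sat-[/] {y} (∀v z ∶ φ) y∉ g~h w = Π-cong-⇔ λ v →
    sat-[/] φ (∨-conicalʳ (eqb z y) _ y∉)
            (Agree-upd v (eqb-false⇒≢ z y (∨-conicalˡ _ (occ y φ) y∉)) g~h) w
  sat-[/] {y} (∃v z ∶ φ) y∉ g~h w = Σ-cong-⇔ λ v →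
    sat-[/] φ (∨-conicalʳ (eqb z y) _ y∉)
            (Agree-upd v (eqb-false⇒≢ z y (∨-conicalˡ _ (occ y φ) y∉)) g~h) w

  Agree-upd-self : ∀ g y v → Agree[ y / y ] (upd {M} g y v) g
  Agree-upd-self g y v z z≢y rewrite rnV-self y z = upd-≢ g v z≢y

  Agree-upd-renamed : ∀ g y x v → Agree[ y / x ] (upd {M} g y v) (upd {M} g x v)
  Agree-upd-renamed g y x v z z≢y with z ≟ x
  ... | yes _ = upd-≡ g y v
  ... | no _  = upd-≢ g v z≢y

  sat-upd-fresh : ∀ {y} φ → occ y φ ≡ false → ∀ g v w →
                  sat M (upd {M} g y v) w φ ⇔ sat M g w φ
  sat-upd-fresh {y} φ y∉ g v w =
    subst (λ ψ → sat M (upd {M} g y v) w ψ ⇔ sat M g w φ) ([/]-self y φ)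
          (sat-[/] φ y∉ (Agree-upd-self g y v) w)

  sat-↓-as-[/] : ∀ {y} x β → occ y β ≡ false → ∀ g w →
                 sat M g w (↓ x ∶ β) ⇔ sat M (upd {M} g y w) w (β [ y / x ])
  sat-↓-as-[/] {y} x β y∉ g w = ⇔.sym (sat-[/] β y∉ (Agree-upd-renamed g y x w) w)

  ∀≤-pin-antecedent : ∀ {y} α γ → occ y α ≡ false → ∀ g →
    Holds∀≤ M g y ((A (var y →f α)) ∧f var y) γ
      ⇔ (∀ w → sat M g w α → sat M (upd {M} g y w) w γ)
  ∀≤-pin-antecedent {y} α γ y∉α g = mk⇔ pinned unpinned
    where
    pinned : Holds∀≤ M g y ((A (var y →f α)) ∧f var y) γ →
             ∀ w → sat M g w α → sat M (upd {M} g y w) w γ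
    pinned H w αw = H w w (α-at-y , upd-≡ g y w)
      where
      α-at-y : ∀ u → upd {M} g y w y ≡ u → sat M (upd {M} g y w) u α
      α-at-y u yu with refl ← trans (sym (upd-≡ g y w)) yu =
        from (sat-upd-fresh α y∉α g w w) αw
    unpinned : (∀ w → sat M g w α → sat M (upd {M} g y w) w γ) →
               Holds∀≤ M g y ((A (var y →f α)) ∧f var y) γ
    unpinned K v w (α-at-y , yw) with refl ← trans (sym (upd-≡ g y v)) yw =
      K v (to (sat-upd-fresh α y∉α g v v) (α-at-y v yw))

  ∀≤-pin-consequent : ∀ {y} α γ → occ y α ≡ false → ∀ g →
    Holds∀≤ M g y γ (var y →f (E (var y ∧f α)))
      ⇔ (∀ w → sat M (upd {M} g y w) w γ → sat M g w α)
  ∀≤-pin-consequent {y} α γ y∉α g = mk⇔ pinned unpinned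
    where
    pinned : Holds∀≤ M g y γ (var y →f (E (var y ∧f α))) →
             ∀ w → sat M (upd {M} g y w) w γ → sat M g w α
    pinned H w γw with H w w γw (upd-≡ g y w)
    ... | u , yu , αu with refl ← trans (sym (upd-≡ g y w)) yu =
      to (sat-upd-fresh α y∉α g w w) αu
    unpinned : (∀ w → sat M (upd {M} g y w) w γ → sat M g w α) →
               Holds∀≤ M g y γ (var y →f (E (var y ∧f α)))
    unpinned K v w γw yw with refl ← trans (sym (upd-≡ g y v)) yw =
      v , yw , from (sat-upd-fresh α y∉α g v v) (K v γw)

lemma6p14 : (M : Model) (g : Assignment M) (α β : Fm) (x y : SVar)
            → occ y α ≡ false → occ y β ≡ false
            → (Holds≤ M g α (↓ x ∶ β)
                 ⇔ Holds∀≤ M g y ((A (var y →f α)) ∧f var y) (β [ y / x ]))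
              × (Holds≤ M g (↓ x ∶ β) α
                 ⇔ Holds∀≤ M g y (β [ y / x ]) (var y →f (E (var y ∧f α))))
lemma6p14 M g α β x y y∉α y∉β =
    ⇔.trans (Π-cong-⇔ λ w → →-cong-⇔ ⇔.refl (↓β⇔β[y/x] w))
            (⇔.sym (∀≤-pin-antecedent M α (β [ y / x ]) y∉α g))
  , ⇔.trans (Π-cong-⇔ λ w → →-cong-⇔ (↓β⇔β[y/x] w) ⇔.refl)
            (⇔.sym (∀≤-pin-consequent M α (β [ y / x ]) y∉α g))
  where
  ↓β⇔β[y/x] : ∀ w → sat M g w (↓ x ∶ β) ⇔ sat M (upd {M} g y w) w (β [ y / x ])
  ↓β⇔β[y/x] = sat-↓-as-[/] M x β y∉β g
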